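{- If $\mathfrak F=\langle W,B\rangle\in\mathsf{LBWE}$, then for all $x,y,a,b,u\in W$: $B(x,a,y)\wedge B(x,b,y)\wedge B(a,u,b)\to B(x,u,y)$.
   Context: A 3-frame is $\langle W,B\rangle$, $B\subseteq W^3$; $\#(x,y,z)$ means pairwise distinct. $\mathsf{LBWE}$: 3-frames satisfying (universal closures of) (B1) $B(x,y,z)\to\#(x,y,z)$; (B2) $B(x,y,z)\to B(z,y,x)$; (B3) $B(x,y,z)\to\neg B(x,z,y)$; (B4) $B(x,y,z)\wedge B(y,z,u)\to B(x,y,u)$; (B5) $B(x,y,z)\wedge B(y,u,z)\to B(x,y,u)$; (B6) $\#(x,y,z)\to B(x,y,z)\vee B(x,z,y)\vee B(y,x,z)$; (B7) $\forall y\exists x\exists z\,B(x,y,z)$. -}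

module Defs where

open import Level using (Level; suc; _⊔_)
open import Data.Product using (_×_; ∃-syntax)
open import Data.Sum using (_⊎_)
open import Relation.Nullary using (¬_)
open import Relation.Binary.PropositionalEquality using (_≡_; _≢_)

record Frame3 (a ℓ : Level) : Set (suc (a ⊔ ℓ)) where
  field
    W : Set a
    B : W → W → W → Set ℓ

# : ∀ {a} {W : Set a} → W → W → W → Set a
# x y z = (x ≢ y) × (y ≢ z) × (x ≢ z)

record IsLBWE {a ℓ} (F : Frame3 a ℓ) : Set (a ⊔ ℓ) where
  open Frame3 F
  field
    B1 : ∀ {x y z} → B x y z → # x y z
    B2 : ∀ {x y z} → B x y z → B z y x
    B3 : ∀ {x y z} → B x y z → ¬ B x z y
    B4 : ∀ {x y z u} → B x y z → B y z u → B x y u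
    B5 : ∀ {x y z u} → B x y z → B y u z → B x y u
    B6 : ∀ {x y z} → # x y z → B x y z ⊎ B x z y ⊎ B y x z
    B7 : ∀ y → ∃[ x ] ∃[ z ] B x y z

{-# OPTIONS --safe #-}
module Submission where

-- By (B6) one of x, p, q lies between the other two. The point x cannot: with
-- B(p,x,q) and B(x,q,y), (B4) would put x between p and y, contradicting B(x,p,y).
-- Up to swapping p and q we may therefore assume B(x,p,q), so x, p, u, q, y lie
-- on a line in this order, and (B4)/(B5) carry u between x and y.

open import Defs
open import Level using (Level)
open import Data.Product using (_,_)
open import Data.Sum using (inj₁; inj₂)
open import Relation.Nullary using (¬_; contradiction)
open import Relation.Binary.PropositionalEquality using (refl)

module LBWEProperties {a ℓ : Level} {F : Frame3 a ℓ} (L : IsLBWE F) where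
  open Frame3 F
  open IsLBWE L

  B-asym₁₂ : ∀ {x y z} → B x y z → ¬ B y x z
  B-asym₁₂ xyz yxz with B1 (B4 (B2 xyz) yxz)
  ... | _ , _ , z≢z = z≢z refl

  B-squeeze : ∀ {x p u q y} → B x p q → B p u q → B x q y → B x u y
  B-squeeze {x} {p} {u} {q} {y} xpq puq xqy = B4 (B2 qux) (B2 yqu)
    where
    qux : B q u x
    qux = B4 (B2 puq) (B2 (B5 xpq puq))
    yqu : B y q u
    yqu = B5 (B2 xqy) qux

  B-convex : ∀ {x y p q u} → B x p y → B x q y → B p u q → B x u y
  B-convex xpy xqy puq with B1 xpy | B1 puq | B1 xqy
  ... | x≢p , _ | _ , _ , p≢q | x≢q , _ with B6 (x≢p , p≢q , x≢q)
  ... | inj₁ xpq        = B-squeeze xpq puq xqy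
  ... | inj₂ (inj₁ xqp) = B-squeeze xqp (B2 puq) xpy
  ... | inj₂ (inj₂ pxq) = contradiction (B4 pxq xqy) (B-asym₁₂ xpy)

lemmaA3 : ∀ {a ℓ : Level} (F : Frame3 a ℓ) → IsLBWE F →
    ∀ (x y p q u : Frame3.W F) →
      Frame3.B F x p y → Frame3.B F x q y → Frame3.B F p u q → Frame3.B F x u y
lemmaA3 F L _ _ _ _ _ = LBWEProperties.B-convex L
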